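{- Let $F, G, F', G'$ be first-order formulas. Let $\vec f' = \mathcal{V}oc(F') \setminus \mathcal{V}oc(G')$, $\vec g' = \mathcal{V}oc(G') \setminus \mathcal{V}oc(F')$, $\vec f = \mathcal{V}oc(F) \setminus \mathcal{V}oc(G)$ and $\vec g = \mathcal{V}oc(G) \setminus \mathcal{V}oc(F)$. Suppose that $\exists \vec f'\, F' \equiv \exists \vec f\, F$, $\forall \vec g'\, G' \equiv \forall \vec g\, G$, $\mathcal{V}oc(\exists \vec f'\, F') = \mathcal{V}oc(\exists \vec f\, F)$, and $\mathcal{V}oc(\forall \vec g'\, G') = \mathcal{V}oc(\forall \vec g\, G)$. Then a first-order formula $H$ is a Craig interpolant for $F, G$ if and only if it is a Craig interpolant for $F', G'$.
   Context: Formulas are of first-order logic without equality (equality may be an axiomatized predicate). For a (possibly second-order) formula $F$, $\mathcal{V}oc(F)$ is the set of predicates with free occurrences in $F$, together with the set of function symbols (constants are 0-ary functions) occurring in $F$ and the set of free individual variables of $F$. The quantifications $\exists \vec f$, $\forall \vec g$ etc. are over tuples of such symbols and are mixed: second-order over predicates and non-constant functions, first-order over constants/free variables (quantification over a constant is treated as first-order quantification over it regarded as an individual variable). $\equiv$ denotes logical equivalence and $\models$ entailment. A Craig interpolant for formulas $F, G$ with $F \models G$ is a formula $H$ with $F \models H$, $H \models G$ and $\mathcal{V}oc(H) \subseteq \mathcal{V}oc(F) \cap \mathcal{V}oc(G)$. -}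

module Defs where

open import Level using (Level; Lift; lift) renaming (zero to lzero; suc to lsuc)
open import Data.Nat using (ℕ; zero; suc)
open import Data.Nat.Properties using () renaming (_≟_ to _≟ℕ_)
open import Data.Vec using (Vec; []; _∷_)
open import Data.List using (List; []; _∷_; _++_; filter)
open import Data.Product using (Σ; _×_; _,_)
open import Data.Sum using (_⊎_)
open import Data.Unit using (⊤)
open import Data.Empty using (⊥)
open import Relation.Nullary using (¬_; Dec; yes; no; ¬?)
open import Relation.Binary.PropositionalEquality using (_≡_; refl; cong)
open import Relation.Binary.Definitions using (DecidableEquality)

-- Symbols of a vocabulary.
--   pred p n : predicate symbol named p of arity n
--   fun  f n : function symbol named f of arity n (n = 0: constant)
--   var  x   : individual variable x

data Symbol : Set where
  pred : ℕ → ℕ → Symbol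
  fun  : ℕ → ℕ → Symbol
  var  : ℕ → Symbol

_≟S_ : DecidableEquality Symbol
pred p n ≟S pred q m with p ≟ℕ q | n ≟ℕ m
... | yes refl | yes refl = yes refl
... | no ne    | _        = no λ { refl → ne refl }
... | yes _    | no ne    = no λ { refl → ne refl }
pred _ _ ≟S fun _ _ = no λ ()
pred _ _ ≟S var _   = no λ ()
fun _ _ ≟S pred _ _ = no λ ()
fun f n ≟S fun g m with f ≟ℕ g | n ≟ℕ m
... | yes refl | yes refl = yes refl
... | no ne    | _        = no λ { refl → ne refl }
... | yes _    | no ne    = no λ { refl → ne refl }
fun _ _ ≟S var _   = no λ ()
var _ ≟S pred _ _  = no λ ()
var _ ≟S fun _ _   = no λ ()
var x ≟S var y with x ≟ℕ y
... | yes refl = yes refl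
... | no ne    = no λ { refl → ne refl }

open import Data.List.Membership.DecPropositional _≟S_ public
  using (_∈_; _∉_; _∈?_)

_∖_ : List Symbol → List Symbol → List Symbol
A ∖ B = filter (λ s → ¬? (s ∈? B)) A

data Term : Set where
  tvar : ℕ → Term
  tapp : (f n : ℕ) → Vec Term n → Term

data Formula : Set where
  atom : (p n : ℕ) → Vec Term n → Formula
  ⊤ᶠ ⊥ᶠ : Formula
  ¬ᶠ_ : Formula → Formula
  _∧ᶠ_ _∨ᶠ_ _⇒ᶠ_ : Formula → Formula → Formula
  ∀ᶠ ∃ᶠ : ℕ → Formula → Formula

-- Vocabulary Voc(F): predicate symbols, function symbols (incl. constants)
-- and free individual variables occurring in F (as a list; read as a set
-- via membership _∈_).

mutual
  vocT : Term → List Symbol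
  vocT (tvar x)     = var x ∷ []
  vocT (tapp f n ts) = fun f n ∷ vocTs ts

  vocTs : ∀ {n} → Vec Term n → List Symbol
  vocTs []       = []
  vocTs (t ∷ ts) = vocT t ++ vocTs ts

voc : Formula → List Symbol
voc (atom p n ts) = pred p n ∷ vocTs ts
voc ⊤ᶠ = []
voc ⊥ᶠ = []
voc (¬ᶠ F) = voc F
voc (F ∧ᶠ G) = voc F ++ voc G
voc (F ∨ᶠ G) = voc F ++ voc G
voc (F ⇒ᶠ G) = voc F ++ voc G
voc (∀ᶠ x F) = voc F ∖ (var x ∷ [])
voc (∃ᶠ x F) = voc F ∖ (var x ∷ [])

data SOFormula : Set where
  fo  : Formula → SOFormula
  ∃ₛ  : List Symbol → SOFormula → SOFormula
  ∀ₛ  : List Symbol → SOFormula → SOFormula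

vocSO : SOFormula → List Symbol
vocSO (fo F)   = voc F
vocSO (∃ₛ S F) = vocSO F ∖ S
vocSO (∀ₛ S F) = vocSO F ∖ S

-- Semantics: an interpretation over a domain D interprets every predicate
-- symbol, every function symbol and every individual variable.
-- (The domain is nonempty because variables denote elements.)

record Interp (D : Set) : Set₁ where
  field
    predI : (p n : ℕ) → Vec D n → Set
    funI  : (f n : ℕ) → Vec D n → D
    varI  : ℕ → D
open Interp public

_[_↦_] : ∀ {D} → Interp D → ℕ → D → Interp D
predI (I [ x ↦ d ]) = predI I
funI  (I [ x ↦ d ]) = funI I
varI  (I [ x ↦ d ]) y with y ≟ℕ x
... | yes _ = d
... | no  _ = varI I y

mutual
  evalT : ∀ {D} → Interp D → Term → D
  evalT I (tvar x)      = varI I x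
  evalT I (tapp f n ts) = funI I f n (evalTs I ts)

  evalTs : ∀ {D n} → Interp D → Vec Term n → Vec D n
  evalTs I []       = []
  evalTs I (t ∷ ts) = evalT I t ∷ evalTs I ts

⟦_⟧ : ∀ {D : Set} → Formula → Interp D → Set
⟦ atom p n ts ⟧ I = predI I p n (evalTs I ts)
⟦ ⊤ᶠ ⟧ I = ⊤
⟦ ⊥ᶠ ⟧ I = ⊥
⟦ ¬ᶠ F ⟧ I = ¬ ⟦ F ⟧ I
⟦ F ∧ᶠ G ⟧ I = ⟦ F ⟧ I × ⟦ G ⟧ I
⟦ F ∨ᶠ G ⟧ I = ⟦ F ⟧ I ⊎ ⟦ G ⟧ I
⟦ F ⇒ᶠ G ⟧ I = ⟦ F ⟧ I → ⟦ G ⟧ I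
⟦ ∀ᶠ x F ⟧ I = (d : _) → ⟦ F ⟧ (I [ x ↦ d ])
⟦ ∃ᶠ x F ⟧ I = Σ _ λ d → ⟦ F ⟧ (I [ x ↦ d ])

SameOn : ∀ {D} → Symbol → Interp D → Interp D → Set
SameOn (pred p n) I J = ∀ v → (predI I p n v → predI J p n v) × (predI J p n v → predI I p n v)
SameOn (fun f n)  I J = ∀ v → funI I f n v ≡ funI J f n v
SameOn (var x)    I J = varI I x ≡ varI J x

AgreeOutside : ∀ {D} → List Symbol → Interp D → Interp D → Set
AgreeOutside S I J = ∀ s → s ∉ S → SameOn s I J

Sat : ∀ {D} → Interp D → SOFormula → Set₁
Sat I (fo F)   = Lift (lsuc lzero) (⟦ F ⟧ I)
Sat I (∃ₛ S F) = Σ (Interp _) λ J → AgreeOutside S I J × Sat J F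
Sat I (∀ₛ S F) = ∀ J → AgreeOutside S I J → Sat J F

_⊨_ : SOFormula → SOFormula → Set₁
A ⊨ B = ∀ {D : Set} (I : Interp D) → Sat I A → Sat I B

_≡ₗ_ : SOFormula → SOFormula → Set₁
A ≡ₗ B = (A ⊨ B) × (B ⊨ A)

_≐_ : List Symbol → List Symbol → Set
A ≐ B = ∀ s → (s ∈ A → s ∈ B) × (s ∈ B → s ∈ A)

IsCraigInterpolant : Formula → Formula → Formula → Set₁
IsCraigInterpolant F G H =
  (fo F ⊨ fo H) × (fo H ⊨ fo G) × (∀ s → s ∈ voc H → s ∈ voc F × s ∈ voc G)

-- H interpolates F, G exactly when ∃f F ⊨ H ⊨ ∀g G and
-- Voc(H) ⊆ Voc(F) ∩ Voc(G): by the coincidence lemma a formula only depends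
-- on the interpretation of its own vocabulary, so H, which avoids f and g,
-- cannot tell F from ∃f F nor G from ∀g G. These conditions survive replacing
-- ∃f F and ∀g G by equivalent formulas of the same vocabulary, because
-- Voc(F) ∩ Voc(G) is precisely Voc(∃f F).
module Submission where

open import Defs
open import Level using (lift; lower)
open import Data.Nat.Properties using () renaming (_≟_ to _≟ℕ_)
open import Data.List using (List; []; _∷_; _++_)
open import Data.List.Relation.Unary.Any using (here; there)
open import Data.List.Relation.Binary.Subset.Propositional using (_⊆_)
open import Data.List.Membership.Propositional.Properties using (∈-filter⁺; ∈-filter⁻; ∈-++⁺ˡ; ∈-++⁺ʳ)
open import Data.Vec using (Vec; []; _∷_)
open import Data.Product using (_×_; _,_; proj₁; proj₂)
open import Data.Sum using (inj₁; inj₂)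
open import Data.Empty using (⊥-elim)
open import Function using (id; _∘_)
open import Function.Bundles using (_⇔_; mk⇔; Equivalence)
open import Relation.Nullary using (yes; no; ¬?)
open import Relation.Binary.PropositionalEquality using (_≡_; refl; sym; trans; cong; cong₂; subst)

private
  variable
    D : Set
    I J : Interp D

SameOn-refl : ∀ s → SameOn s I I
SameOn-refl (pred p n) v = id , id
SameOn-refl (fun f n)  v = refl
SameOn-refl (var x)      = refl

SameOn-sym : ∀ s → SameOn s I J → SameOn s J I
SameOn-sym (pred p n) same v = proj₂ (same v) , proj₁ (same v)
SameOn-sym (fun f n)  same v = sym (same v)
SameOn-sym (var x)    same   = sym same

AgreeOn : List Symbol → Interp D → Interp D → Set
AgreeOn L I J = ∀ s → s ∈ L → SameOn s I J

AgreeOn-sym : ∀ {L} → AgreeOn L I J → AgreeOn L J I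
AgreeOn-sym agree s s∈L = SameOn-sym s (agree s s∈L)

AgreeOn-++ˡ : ∀ {L M} → AgreeOn (L ++ M) I J → AgreeOn L I J
AgreeOn-++ˡ agree s s∈L = agree s (∈-++⁺ˡ s∈L)

AgreeOn-++ʳ : ∀ L {M} → AgreeOn (L ++ M) I J → AgreeOn M I J
AgreeOn-++ʳ L agree s s∈M = agree s (∈-++⁺ʳ L s∈M)

AgreeOn-outside : ∀ {L S} → (∀ s → s ∈ L → s ∉ S) → AgreeOutside S I J → AgreeOn L I J
AgreeOn-outside disjoint agree s s∈L = agree s (disjoint s s∈L)

∈-∖⁺ : ∀ {s A B} → s ∈ A → s ∉ B → s ∈ A ∖ B
∈-∖⁺ {B = B} = ∈-filter⁺ (λ t → ¬? (t ∈? B))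

∈-∖⁻ : ∀ {s} A B → s ∈ A ∖ B → s ∈ A × s ∉ B
∈-∖⁻ A B = ∈-filter⁻ (λ t → ¬? (t ∈? B)) {xs = A}

∈-∖-∖⁺ : ∀ {s} A B → s ∈ A → s ∈ B → s ∈ A ∖ (A ∖ B)
∈-∖-∖⁺ A B s∈A s∈B = ∈-∖⁺ s∈A (λ s∈A∖B → proj₂ (∈-∖⁻ A B s∈A∖B) s∈B)

∈-∖-∖⁻ : ∀ {s} A B → s ∈ A ∖ (A ∖ B) → s ∈ A × s ∈ B
∈-∖-∖⁻ {s} A B s∈ with ∈-∖⁻ A (A ∖ B) s∈ | s ∈? B
... | s∈A , _     | yes s∈B = s∈A , s∈B
... | s∈A , s∉A∖B | no s∉B  = ⊥-elim (s∉A∖B (∈-∖⁺ s∈A s∉B))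

∉-∖ : ∀ {s} A B → s ∈ B → s ∉ A ∖ B
∉-∖ A B s∈B s∈A∖B = proj₂ (∈-∖⁻ A B s∈A∖B) s∈B

mutual
  evalT-coincidence : ∀ t → AgreeOn (vocT t) I J → evalT I t ≡ evalT J t
  evalT-coincidence (tvar x) agree = agree (var x) (here refl)
  evalT-coincidence {I = I} (tapp f n ts) agree =
    trans (cong (funI I f n) (evalTs-coincidence ts (λ s → agree s ∘ there)))
          (agree (fun f n) (here refl) _)

  evalTs-coincidence : ∀ {n} (ts : Vec Term n) → AgreeOn (vocTs ts) I J → evalTs I ts ≡ evalTs J ts
  evalTs-coincidence []       agree = refl
  evalTs-coincidence (t ∷ ts) agree =
    cong₂ _∷_ (evalT-coincidence t (AgreeOn-++ˡ agree))
              (evalTs-coincidence ts (AgreeOn-++ʳ (vocT t) agree))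

AgreeOn-update : ∀ x d L → AgreeOn (L ∖ (var x ∷ [])) I J → AgreeOn L (I [ x ↦ d ]) (J [ x ↦ d ])
AgreeOn-update x d L agree (pred p n) s∈L = agree (pred p n) (∈-∖⁺ s∈L λ { (here ()) ; (there ()) })
AgreeOn-update x d L agree (fun f n)  s∈L = agree (fun f n) (∈-∖⁺ s∈L λ { (here ()) ; (there ()) })
AgreeOn-update x d L agree (var y)    s∈L with y ≟ℕ x
... | yes _   = refl
... | no y≢x  = agree (var y) (∈-∖⁺ s∈L λ { (here refl) → y≢x refl ; (there ()) })

⟦⟧-coincidence : ∀ F → AgreeOn (voc F) I J → ⟦ F ⟧ I → ⟦ F ⟧ J
⟦⟧-coincidence {I = I} (atom p n ts) agree holds =
  proj₁ (agree (pred p n) (here refl) _)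
        (subst (predI I p n) (evalTs-coincidence ts (λ s → agree s ∘ there)) holds)
⟦⟧-coincidence ⊤ᶠ agree holds = holds
⟦⟧-coincidence ⊥ᶠ agree holds = holds
⟦⟧-coincidence (¬ᶠ F) agree holds = holds ∘ ⟦⟧-coincidence F (AgreeOn-sym agree)
⟦⟧-coincidence (F ∧ᶠ G) agree (holdsF , holdsG) =
  ⟦⟧-coincidence F (AgreeOn-++ˡ agree) holdsF , ⟦⟧-coincidence G (AgreeOn-++ʳ (voc F) agree) holdsG
⟦⟧-coincidence (F ∨ᶠ G) agree (inj₁ holdsF) = inj₁ (⟦⟧-coincidence F (AgreeOn-++ˡ agree) holdsF)
⟦⟧-coincidence (F ∨ᶠ G) agree (inj₂ holdsG) = inj₂ (⟦⟧-coincidence G (AgreeOn-++ʳ (voc F) agree) holdsG)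
⟦⟧-coincidence (F ⇒ᶠ G) agree holds =
  ⟦⟧-coincidence G (AgreeOn-++ʳ (voc F) agree) ∘ holds ∘ ⟦⟧-coincidence F (AgreeOn-sym (AgreeOn-++ˡ agree))
⟦⟧-coincidence (∀ᶠ x F) agree holds d = ⟦⟧-coincidence F (AgreeOn-update x d (voc F) agree) (holds d)
⟦⟧-coincidence (∃ᶠ x F) agree (d , holds) = d , ⟦⟧-coincidence F (AgreeOn-update x d (voc F) agree) holds

⊨-∃ₛ : ∀ {S A} → A ⊨ ∃ₛ S A
⊨-∃ₛ I holds = I , (λ s _ → SameOn-refl s) , holds

∀ₛ-⊨ : ∀ {S A} → ∀ₛ S A ⊨ A
∀ₛ-⊨ I holds = holds I (λ s _ → SameOn-refl s)

∃ₛ-⊨-fo : ∀ {S A} H → (∀ s → s ∈ voc H → s ∉ S) → A ⊨ fo H → ∃ₛ S A ⊨ fo H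
∃ₛ-⊨-fo H disjoint A⊨H I (J , agree , holds) =
  lift (⟦⟧-coincidence H (AgreeOn-sym (AgreeOn-outside disjoint agree)) (lower (A⊨H J holds)))

fo-⊨-∀ₛ : ∀ {S A} H → (∀ s → s ∈ voc H → s ∉ S) → fo H ⊨ A → fo H ⊨ ∀ₛ S A
fo-⊨-∀ₛ H disjoint H⊨A I (lift holds) J agree =
  H⊨A J (lift (⟦⟧-coincidence H (AgreeOn-outside disjoint agree) holds))

∃-unshared : Formula → Formula → SOFormula
∃-unshared F G = ∃ₛ (voc F ∖ voc G) (fo F)

∀-unshared : Formula → Formula → SOFormula
∀-unshared G F = ∀ₛ (voc G ∖ voc F) (fo G)

IsCraigInterpolantₛ : Formula → Formula → Formula → Set₁
IsCraigInterpolantₛ F G H =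
  (∃-unshared F G ⊨ fo H) × (fo H ⊨ ∀-unshared G F) × (voc H ⊆ vocSO (∃-unshared F G))

isCraigInterpolant⇔ₛ : ∀ F G H → IsCraigInterpolant F G H ⇔ IsCraigInterpolantₛ F G H
isCraigInterpolant⇔ₛ F G H = mk⇔ to from
  where
  to : IsCraigInterpolant F G H → IsCraigInterpolantₛ F G H
  to (F⊨H , H⊨G , H⊆F∩G) =
    ∃ₛ-⊨-fo {A = fo F} H (λ s → ∉-∖ (voc F) (voc G) ∘ proj₂ ∘ H⊆F∩G s) F⊨H ,
    fo-⊨-∀ₛ {A = fo G} H (λ s → ∉-∖ (voc G) (voc F) ∘ proj₁ ∘ H⊆F∩G s) H⊨G ,
    λ {s} s∈H → ∈-∖-∖⁺ (voc F) (voc G) (proj₁ (H⊆F∩G s s∈H)) (proj₂ (H⊆F∩G s s∈H))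

  from : IsCraigInterpolantₛ F G H → IsCraigInterpolant F G H
  from (∃F⊨H , H⊨∀G , H⊆F∩G) =
    (λ I → ∃F⊨H I ∘ ⊨-∃ₛ {A = fo F} I) , (λ I → ∀ₛ-⊨ {A = fo G} I ∘ H⊨∀G I) ,
    λ s → ∈-∖-∖⁻ (voc F) (voc G) ∘ H⊆F∩G

IsCraigInterpolantₛ-transfer : ∀ F G F′ G′ H →
  ∃-unshared F′ G′ ⊨ ∃-unshared F G → ∀-unshared G F ⊨ ∀-unshared G′ F′ →
  vocSO (∃-unshared F G) ⊆ vocSO (∃-unshared F′ G′) →
  IsCraigInterpolantₛ F G H → IsCraigInterpolantₛ F′ G′ H
IsCraigInterpolantₛ-transfer F G F′ G′ H ∃F′⊨∃F ∀G⊨∀G′ F∩G⊆F′∩G′ (∃F⊨H , H⊨∀G , H⊆F∩G) =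
  (λ I → ∃F⊨H I ∘ ∃F′⊨∃F I) , (λ I → ∀G⊨∀G′ I ∘ H⊨∀G I) , F∩G⊆F′∩G′ ∘ H⊆F∩G

mainTheorem1 : (F G F′ G′ : Formula) →
    ∃ₛ (voc F′ ∖ voc G′) (fo F′) ≡ₗ ∃ₛ (voc F ∖ voc G) (fo F) →
    ∀ₛ (voc G′ ∖ voc F′) (fo G′) ≡ₗ ∀ₛ (voc G ∖ voc F) (fo G) →
    vocSO (∃ₛ (voc F′ ∖ voc G′) (fo F′)) ≐ vocSO (∃ₛ (voc F ∖ voc G) (fo F)) →
    vocSO (∀ₛ (voc G′ ∖ voc F′) (fo G′)) ≐ vocSO (∀ₛ (voc G ∖ voc F) (fo G)) →
    (H : Formula) →
    (IsCraigInterpolant F G H → IsCraigInterpolant F′ G′ H) ×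
    (IsCraigInterpolant F′ G′ H → IsCraigInterpolant F G H)
mainTheorem1 F G F′ G′ (∃F′⊨∃F , ∃F⊨∃F′) (∀G′⊨∀G , ∀G⊨∀G′) voc≐ _ H =
  via (isCraigInterpolant⇔ₛ F G H) (isCraigInterpolant⇔ₛ F′ G′ H)
      (IsCraigInterpolantₛ-transfer F G F′ G′ H ∃F′⊨∃F ∀G⊨∀G′ (λ {s} → proj₂ (voc≐ s))) ,
  via (isCraigInterpolant⇔ₛ F′ G′ H) (isCraigInterpolant⇔ₛ F G H)
      (IsCraigInterpolantₛ-transfer F′ G′ F G H ∃F⊨∃F′ ∀G′⊨∀G (λ {s} → proj₁ (voc≐ s)))
  where
  via : ∀ {A A′ B B′ : Set₁} → A ⇔ B → A′ ⇔ B′ → (B → B′) → A → A′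
  via A⇔B A′⇔B′ transfer = Equivalence.from A′⇔B′ ∘ transfer ∘ Equivalence.to A⇔B
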